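{- Let $n,m\ge 1$ and $\Lambda_{n,m}=\{1,\dots,n\}\times\{1,\dots,m\}\subset\mathbb{A}$. Every maximal configuration $\eta\in\{0,1\}^{\Lambda_{n,m}}$ is compatible, i.e., there exists $\omega\in\mathcal{X}(\mathbb{A})$ with $\omega_{\Lambda_{n,m}}=\eta$.
   Context: $\mathbb{A}$ is the triangular lattice $\{x\mathbf{b}_1+y\mathbf{b}_2: x,y\in\mathbb{Z}\}$ with $\mathbf{b}_1=(1,0)$, $\mathbf{b}_2=(\tfrac12,\tfrac{\sqrt3}{2})$; sites are labeled by their coordinates $(x,y)$ in this basis, and two sites are adjacent iff they are at Euclidean distance $1$ (i.e., their coordinates differ by $\pm(1,0)$, $\pm(0,1)$ or $\pm(1,-1)$). $\mathcal{X}(\mathbb{A})$ is the set of configurations $\omega\in\{0,1\}^{\mathbb{A}}$ such that for every site $i$, $\omega_i=1$ iff $\omega_j=0$ for all sites $j$ adjacent to $i$; equivalently, the support of $\omega$ is a maximal independent set of $\mathbb{A}$. For a finite region $\Lambda$, $\omega_\Lambda$ is the restriction of $\omega$ to $\Lambda$. A configuration $\eta$ on a finite region $\Lambda$ is called maximal if no two adjacent sites of $\Lambda$ both carry $1$ and every site of $\Lambda$ carrying $0$ is adjacent to some site of $\Lambda$ carrying $1$ (i.e., its support is a maximal independent set of the subgraph induced on $\Lambda$); it is called compatible if $\eta=\omega_\Lambda$ for some $\omega\in\mathcal{X}(\mathbb{A})$. -}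

module Defs where

open import Data.Bool using (Bool; true; false)
open import Data.Integer using (ℤ; +_; -[1+_]; _+_; _-_)
open import Data.Nat using (ℕ; suc)
open import Data.Fin using (Fin; toℕ)
open import Data.Product using (_×_; _,_; ∃-syntax)
open import Data.Sum using (_⊎_)
open import Relation.Binary.PropositionalEquality using (_≡_)
open import Relation.Nullary using (¬_)

-- Sites of the triangular lattice 𝔸, labelled by coordinates (x , y)
-- in the basis b₁ = (1,0), b₂ = (1/2, √3/2).
Site : Set
Site = ℤ × ℤ

-- Adjacency: coordinates differ by ±(1,0), ±(0,1) or ±(1,-1).
-- (equivalently: Euclidean distance 1)
data Adj : Site → Site → Set where
  e+  : ∀ x y → Adj (x , y) (x + + 1 , y)
  e-  : ∀ x y → Adj (x , y) (x - + 1 , y)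
  n+  : ∀ x y → Adj (x , y) (x , y + + 1)
  n-  : ∀ x y → Adj (x , y) (x , y - + 1)
  d+  : ∀ x y → Adj (x , y) (x + + 1 , y - + 1)
  d-  : ∀ x y → Adj (x , y) (x - + 1 , y + + 1)

InX : (Site → Bool) → Set
InX ω = ∀ i → (ω i ≡ true → ∀ j → Adj i j → ω j ≡ false)
             × ((∀ j → Adj i j → ω j ≡ false) → ω i ≡ true)

site : ∀ {n m} → Fin n → Fin m → Site
site a b = (+ suc (toℕ a) , + suc (toℕ b))

BoxConf : ℕ → ℕ → Set
BoxConf n m = Fin n → Fin m → Bool

BoxAdj : ∀ {n m} → (Fin n × Fin m) → (Fin n × Fin m) → Set
BoxAdj (a , b) (c , d) = Adj (site a b) (site c d)

Maximal : ∀ {n m} → BoxConf n m → Set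
Maximal {n} {m} η =
    (∀ a b c d → BoxAdj (a , b) (c , d) → ¬ (η a b ≡ true × η c d ≡ true))
  × (∀ a b → η a b ≡ false →
       ∃[ c ] ∃[ d ] (BoxAdj (a , b) (c , d) × η c d ≡ true))

Compatible : ∀ {n m} → BoxConf n m → Set
Compatible {n} {m} η =
  ∃[ ω ] (InX ω × (∀ (a : Fin n) (b : Fin m) → ω (site a b) ≡ η a b))

-- Extend the support of η greedily. The lattice is properly 3-coloured by
-- x − y mod 3, so each colour class is independent: adding at once every site
-- of one colour that has no occupied neighbour keeps the set independent and
-- leaves every site of that colour occupied or next to an occupied site.
-- After one sweep per colour the set is a maximal independent set of 𝔸
-- containing the support of η, and it has no further sites in the box because
-- maximality of η gives every zero of η an occupied neighbour in the box.
module Submission where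

open import Defs
open import Data.Nat using (ℕ; _≥_)

open import Data.Bool using (Bool; true; false; _∨_; _∧_; not)
open import Data.Bool.Properties as Bool using (¬-not)
open import Data.Empty using (⊥)
import Data.Fin.Properties as Fin
open import Data.Integer using (ℤ; +_; _+_; _-_; -_; _*_; _%ℕ_; _/ℕ_)
open import Data.Integer.Divisibility.Signed using (_∣_; divides; _∣?_)
open import Data.Integer.DivMod using (a≡a%ℕn+[a/ℕn]*n; n%ℕd<d)
import Data.Integer.Properties as ℤ
open import Data.Integer.Tactic.RingSolver using (solve-∀)
open import Data.List using (List; []; _∷_; map; upTo)
open import Data.List.Membership.Propositional using (_∈_; find; lose)
open import Data.List.Membership.Propositional.Properties using (∈-map⁺; ∈-upTo⁺)
open import Data.List.Relation.Unary.All as All using (All; []; _∷_)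
import Data.List.Relation.Unary.All.Properties as All
open import Data.List.Relation.Unary.Any using (Any; here; there; any?)
import Data.Nat as ℕ
open import Data.Product using (_×_; _,_; ∃-syntax; proj₁; proj₂)
open import Data.Product.Properties using (≡-dec)
open import Data.Sum using (_⊎_; inj₁; inj₂)
open import Relation.Binary.Definitions using (Symmetric)
open import Relation.Binary.PropositionalEquality
open import Relation.Nullary using (¬_; Dec; yes; no; does)
open import Relation.Nullary.Decidable using (_×-dec_; dec-true; from-no)

does≡true⇒ : ∀ {A : Set} (a? : Dec A) → does a? ≡ true → A
does≡true⇒ (yes a) _ = a

%ℕ≡%ℕ⇒∣- : ∀ a b d .{{_ : ℕ.NonZero d}} → a %ℕ d ≡ b %ℕ d → + d ∣ a - b
%ℕ≡%ℕ⇒∣- a b d a%d≡b%d = divides (p - q) (begin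
  a - b                               ≡⟨ cong₂ _-_ (a≡a%ℕn+[a/ℕn]*n a d) (a≡a%ℕn+[a/ℕn]*n b d) ⟩
  (+ r + p * + d) - (+ r′ + q * + d)  ≡⟨ cong (λ r″ → (+ r″ + p * + d) - (+ r′ + q * + d)) a%d≡b%d ⟩
  (+ r′ + p * + d) - (+ r′ + q * + d) ≡⟨ cancel (+ r′) p q (+ d) ⟩
  (p - q) * + d                       ∎)
  where
  open ≡-Reasoning
  r r′ : ℕ
  r = a %ℕ d
  r′ = b %ℕ d
  p q : ℤ
  p = a /ℕ d
  q = b /ℕ d
  cancel : ∀ k p q d → (k + p * d) - (k + q * d) ≡ (p - q) * d
  cancel = solve-∀

module MaximalIndependentExtension
  {V : Set} (_~_ : V → V → Set) (~-sym : Symmetric _~_)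
  (neighbours : V → List V)
  (∈-neighbours⁺ : ∀ {x y} → x ~ y → y ∈ neighbours x)
  (∈-neighbours⁻ : ∀ {x y} → y ∈ neighbours x → x ~ y)
  where

  Subset : Set
  Subset = V → Bool

  _⊆_ : Subset → Subset → Set
  S ⊆ X = ∀ {x} → S x ≡ true → X x ≡ true

  Independent : Subset → Set
  Independent S = ∀ {x y} → x ~ y → S x ≡ true → S y ≡ true → ⊥

  Dominates : Subset → V → Set
  Dominates X x = X x ≡ true ⊎ ∃[ y ] (x ~ y × X y ≡ true)

  MaximalIndependent : Subset → Set
  MaximalIndependent X = ∀ x → (X x ≡ true → ∀ y → x ~ y → X y ≡ false)
                             × ((∀ y → x ~ y → X y ≡ false) → X x ≡ true)

  independent∧dominating⇒maximal : ∀ {X} → Independent X → (∀ x → Dominates X x) →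
                                   MaximalIndependent X
  independent∧dominating⇒maximal {X} X-indep X-dom x = isolated , occupied
    where
    isolated : X x ≡ true → ∀ y → x ~ y → X y ≡ false
    isolated Xx y x~y = ¬-not (X-indep x~y Xx)

    occupied : (∀ y → x ~ y → X y ≡ false) → X x ≡ true
    occupied isolated with X-dom x
    ... | inj₁ Xx = Xx
    ... | inj₂ (y , x~y , Xy) with () ← trans (sym Xy) (isolated y x~y)

  dominates-mono : ∀ {S X x} → S ⊆ X → Dominates S x → Dominates X x
  dominates-mono S⊆X (inj₁ Sx) = inj₁ (S⊆X Sx)
  dominates-mono S⊆X (inj₂ (y , x~y , Sy)) = inj₂ (y , x~y , S⊆X Sy)

  hasNeighbourIn? : (S : Subset) (x : V) → Dec (Any (λ y → S y ≡ true) (neighbours x))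
  hasNeighbourIn? S x = any? (λ y → S y Bool.≟ true) (neighbours x)

  extend : Subset → Subset → Subset
  extend P S x = S x ∨ (P x ∧ not (does (hasNeighbourIn? S x)))

  module _ {P S : Subset} where

    ⊆-extend : S ⊆ extend P S
    ⊆-extend {x} Sx rewrite Sx = refl

    extend-cases : ∀ {x} → extend P S x ≡ true →
                   S x ≡ true ⊎ (P x ≡ true × (∀ {y} → x ~ y → S y ≡ false))
    extend-cases {x} added with S x
    ... | true = inj₁ refl
    ... | false with P x | hasNeighbourIn? S x
    ...   | true  | no noNeighbour =
      inj₂ (refl , λ x~y → ¬-not (λ Sy → noNeighbour (lose (∈-neighbours⁺ x~y) Sy)))
    ...   | true  | yes _ with () ← added
    ...   | false | _     with () ← added

    extend-independent : Independent P → Independent S → Independent (extend P S)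
    extend-independent P-indep S-indep {x} {y} x~y Ex Ey
      with extend-cases Ex | extend-cases Ey
    ... | inj₁ Sx | inj₁ Sy = S-indep x~y Sx Sy
    ... | inj₁ Sx | inj₂ (_ , isolated-y) with () ← trans (sym Sx) (isolated-y (~-sym x~y))
    ... | inj₂ (_ , isolated-x) | inj₁ Sy with () ← trans (sym Sy) (isolated-x x~y)
    ... | inj₂ (Px , _) | inj₂ (Py , _) = P-indep x~y Px Py

    extend-dominates : ∀ {x} → P x ≡ true → Dominates (extend P S) x
    extend-dominates {x} Px with S x | hasNeighbourIn? S x
    ... | true  | _ = inj₁ refl
    ... | false | yes hasNeighbour =
      let y , y∈ , Sy = find hasNeighbour in inj₂ (y , ∈-neighbours⁻ y∈ , ⊆-extend Sy)
    ... | false | no _ rewrite Px = inj₁ refl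

  extendAll : List Subset → Subset → Subset
  extendAll []       S = S
  extendAll (P ∷ Ps) S = extendAll Ps (extend P S)

  ⊆-extendAll : ∀ Ps {S} → S ⊆ extendAll Ps S
  ⊆-extendAll []       Sx = Sx
  ⊆-extendAll (P ∷ Ps) Sx = ⊆-extendAll Ps (⊆-extend {P} Sx)

  extendAll-independent : ∀ {Ps S} → All Independent Ps → Independent S →
                          Independent (extendAll Ps S)
  extendAll-independent []                 S-indep = S-indep
  extendAll-independent {P ∷ _} {S} (P-indep ∷ Ps-indep) S-indep =
    extendAll-independent Ps-indep (extend-independent {P} {S} P-indep S-indep)

  extendAll-dominates : ∀ {Ps S x} → Any (λ P → P x ≡ true) Ps → Dominates (extendAll Ps S) x
  extendAll-dominates {P ∷ Ps} {S} (here Px) =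
    dominates-mono (⊆-extendAll Ps) (extend-dominates {P} {S} Px)
  extendAll-dominates (there Psx) = extendAll-dominates Psx

  maximalIndependent-⊇ : (Ps : List Subset) → All Independent Ps →
                         (∀ x → Any (λ P → P x ≡ true) Ps) →
                         ∀ {S} → Independent S → ∃[ X ] (S ⊆ X × MaximalIndependent X)
  maximalIndependent-⊇ Ps Ps-indep Ps-cover S-indep =
    extendAll Ps _ , ⊆-extendAll Ps ,
    independent∧dominating⇒maximal (extendAll-independent Ps-indep S-indep)
                                   (λ x → extendAll-dominates (Ps-cover x))

x+1-1≡x : ∀ x → x + + 1 - + 1 ≡ x
x+1-1≡x = solve-∀

x-1+1≡x : ∀ x → x - + 1 + + 1 ≡ x
x-1+1≡x = solve-∀

Adj-sym : Symmetric Adj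
Adj-sym (e+ x y) = subst (λ x′ → Adj (x + + 1 , y) (x′ , y)) (x+1-1≡x x) (e- (x + + 1) y)
Adj-sym (e- x y) = subst (λ x′ → Adj (x - + 1 , y) (x′ , y)) (x-1+1≡x x) (e+ (x - + 1) y)
Adj-sym (n+ x y) = subst (λ y′ → Adj (x , y + + 1) (x , y′)) (x+1-1≡x y) (n- x (y + + 1))
Adj-sym (n- x y) = subst (λ y′ → Adj (x , y - + 1) (x , y′)) (x-1+1≡x y) (n+ x (y - + 1))
Adj-sym (d+ x y) = subst₂ (λ x′ y′ → Adj (x + + 1 , y - + 1) (x′ , y′))
                          (x+1-1≡x x) (x-1+1≡x y) (d- (x + + 1) (y - + 1))
Adj-sym (d- x y) = subst₂ (λ x′ y′ → Adj (x - + 1 , y + + 1) (x′ , y′))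
                          (x-1+1≡x x) (x+1-1≡x y) (d+ (x - + 1) (y + + 1))

neighbours : Site → List Site
neighbours (x , y) = (x + + 1 , y) ∷ (x - + 1 , y) ∷ (x , y + + 1) ∷ (x , y - + 1)
                   ∷ (x + + 1 , y - + 1) ∷ (x - + 1 , y + + 1) ∷ []

∈-neighbours⁺ : ∀ {s t} → Adj s t → t ∈ neighbours s
∈-neighbours⁺ (e+ x y) = here refl
∈-neighbours⁺ (e- x y) = there (here refl)
∈-neighbours⁺ (n+ x y) = there (there (here refl))
∈-neighbours⁺ (n- x y) = there (there (there (here refl)))
∈-neighbours⁺ (d+ x y) = there (there (there (there (here refl))))
∈-neighbours⁺ (d- x y) = there (there (there (there (there (here refl)))))

∈-neighbours⁻ : ∀ {s t} → t ∈ neighbours s → Adj s t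
∈-neighbours⁻ {x , y} (here refl)                                         = e+ x y
∈-neighbours⁻ {x , y} (there (here refl))                                 = e- x y
∈-neighbours⁻ {x , y} (there (there (here refl)))                         = n+ x y
∈-neighbours⁻ {x , y} (there (there (there (here refl))))                 = n- x y
∈-neighbours⁻ {x , y} (there (there (there (there (here refl)))))         = d+ x y
∈-neighbours⁻ {x , y} (there (there (there (there (there (here refl)))))) = d- x y

open MaximalIndependentExtension Adj Adj-sym neighbours ∈-neighbours⁺ ∈-neighbours⁻

level : Site → ℤ
level (x , y) = x - y

colour : Site → ℕ
colour s = level s %ℕ 3

level-stepˣ : ∀ x y a → (x - y) - ((x + a) - y) ≡ - a
level-stepˣ = solve-∀

level-stepʸ : ∀ x y b → (x - y) - (x - (y + b)) ≡ b
level-stepʸ = solve-∀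

level-stepˣʸ : ∀ x y a b → (x - y) - ((x + a) - (y + b)) ≡ b - a
level-stepˣʸ = solve-∀

-- x - + 1 unfolds to x + - + 1, so every Adj constructor is an instance of a level-step lemma.
Adj⇒3∤Δlevel : ∀ {s t} → Adj s t → ¬ (+ 3 ∣ level s - level t)
Adj⇒3∤Δlevel (e+ x y) rewrite level-stepˣ x y (+ 1) = from-no (+ 3 ∣? - + 1)
Adj⇒3∤Δlevel (e- x y) rewrite level-stepˣ x y (- + 1) = from-no (+ 3 ∣? + 1)
Adj⇒3∤Δlevel (n+ x y) rewrite level-stepʸ x y (+ 1) = from-no (+ 3 ∣? + 1)
Adj⇒3∤Δlevel (n- x y) rewrite level-stepʸ x y (- + 1) = from-no (+ 3 ∣? - + 1)
Adj⇒3∤Δlevel (d+ x y) rewrite level-stepˣʸ x y (+ 1) (- + 1) = from-no (+ 3 ∣? - + 2)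
Adj⇒3∤Δlevel (d- x y) rewrite level-stepˣʸ x y (- + 1) (+ 1) = from-no (+ 3 ∣? + 2)

colour-proper : ∀ {s t} → Adj s t → colour s ≢ colour t
colour-proper {s} {t} adj same = Adj⇒3∤Δlevel adj (%ℕ≡%ℕ⇒∣- (level s) (level t) 3 same)

colourClass : ℕ → Subset
colourClass c s = does (colour s ℕ.≟ c)

colourClass-independent : ∀ c → Independent (colourClass c)
colourClass-independent c {s} {t} adj s∈c t∈c =
  colour-proper adj (trans (does≡true⇒ (colour s ℕ.≟ c) s∈c)
                           (sym (does≡true⇒ (colour t ℕ.≟ c) t∈c)))

colourClasses : List Subset
colourClasses = map colourClass (upTo 3)

colourClasses-independent : All Independent colourClasses
colourClasses-independent = All.map⁺ (All.universal colourClass-independent (upTo 3))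

colourClasses-cover : ∀ s → Any (λ P → P s ≡ true) colourClasses
colourClasses-cover s =
  lose (∈-map⁺ colourClass (∈-upTo⁺ (n%ℕd<d (level s) 3))) (dec-true (colour s ℕ.≟ colour s) refl)

module _ {n m} (η : BoxConf n m) where

  Occupied : Site → Set
  Occupied s = ∃[ a ] ∃[ b ] (s ≡ site a b × η a b ≡ true)

  occupied? : ∀ s → Dec (Occupied s)
  occupied? s = Fin.any? λ a → Fin.any? λ b →
    ≡-dec ℤ._≟_ ℤ._≟_ s (site a b) ×-dec η a b Bool.≟ true

  support : Subset
  support s = does (occupied? s)

  support-independent : Maximal η → Independent support
  support-independent η-max {s} {t} adj s∈ t∈
    with does≡true⇒ (occupied? s) s∈ | does≡true⇒ (occupied? t) t∈
  ... | a , b , refl , ηab | c , d , refl , ηcd = proj₁ η-max a b c d adj (ηab , ηcd)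

  restriction-≡ : Maximal η → ∀ {X} → support ⊆ X → MaximalIndependent X →
                  ∀ a b → X (site a b) ≡ η a b
  restriction-≡ η-max support⊆X X-max a b with η a b in ηab
  ... | true  = support⊆X (dec-true (occupied? (site a b)) (a , b , refl , ηab))
  ... | false =
    let c , d , adj , ηcd = proj₂ η-max a b ηab
        X-cd = support⊆X (dec-true (occupied? (site c d)) (c , d , refl , ηcd))
    in proj₁ (X-max (site c d)) X-cd (site a b) (Adj-sym adj)

lemma1 : (n m : ℕ) → n ≥ 1 → m ≥ 1 → (η : BoxConf n m) →
    Maximal η → Compatible η
lemma1 n m _ _ η η-max =
  let X , support⊆X , X-max = maximalIndependent-⊇ colourClasses colourClasses-independent
                                colourClasses-cover (support-independent η η-max)
  in X , X-max , restriction-≡ η η-max support⊆X X-max
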